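{- Let $d\ge1$ and let $W$ be a $d$-colorful word on an alphabet $\sigma$ with $|\sigma|\ge 2$. Then for every $\tau\subseteq\sigma$ with $|\tau|\ge 2$, $W$ contains a $d$-colorful subword on alphabet $\tau$.
   Context: A subword is obtained by deleting some (possibly none) letter occurrences. For an alphabet $\sigma$ with $|\sigma|=r\ge2$, a $d$-colorful word on $\sigma$ is a word of length $(d+1)(r-1)+1$ such that for every $i\in[d+1]$ the segment at positions $(i-1)(r-1)+1$ through $i(r-1)+1$ inclusive contains every letter of $\sigma$ exactly once. -}

module Defs where

open import Data.Nat using (ℕ; suc; _+_; _*_; _∸_; _<_)
open import Data.List using (List; length; take; drop; filter)
open import Data.List.Relation.Unary.All using (All)
open import Data.List.Membership.Propositional using (_∈_)
open import Relation.Binary.PropositionalEquality using (_≡_)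
open import Relation.Binary.Definitions using (DecidableEquality)

module _ {A : Set} (_≟_ : DecidableEquality A) where

  occ : A → List A → ℕ
  occ a w = length (filter (_≟ a) w)

  -- the i-th segment (i = 0 … d, i.e. segment number i+1 of the paper):
  -- positions i(r-1)+1 … (i+1)(r-1)+1 (1-based), r letters in total
  segment : ℕ → ℕ → List A → List A
  segment r i w = take r (drop (i * (r ∸ 1)) w)

  -- W is a d-colorful word on the alphabet σ (σ given as a duplicate-free list,
  -- so |σ| = length σ). Also requires the word to be a word over σ.
  Colorful : ℕ → List A → List A → Set
  Colorful d σ W =
    All (_∈ σ) W ×′
    (length W ≡ suc d * (length σ ∸ 1) + 1) ×′
    ((i : ℕ) → i < suc d → (a : A) → a ∈ σ → occ a (segment (length σ) i W) ≡ 1)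
    where open import Data.Product using () renaming (_×_ to _×′_)

-- A d-colorful word is a chain of d + 1 permutations of σ, consecutive ones sharing their
-- boundary letter. The subword on τ is chosen segment by segment, greedily from the left:
-- the τ-segment number i consists of the letter c it shares with the previous τ-segment
-- (none for i = 0), followed by the remaining letters of τ in the order in which they occur
-- in the σ-segment number i. Its last letter is then carried over to the next τ-segment.
-- The carried letter c is either the first letter of the next σ-segment, or it lies
-- strictly before it, so the chosen letters always appear in W in increasing positions.
module Submission where

open import Defs
open import Data.Nat using (ℕ; _≤_)
open import Data.List using (List; length)
open import Data.List.Relation.Unary.Unique.Propositional using (Unique)
open import Data.List.Relation.Unary.All using (All)
open import Data.List.Membership.Propositional using (_∈_)
open import Data.List.Relation.Binary.Sublist.Propositional using (_⊆_)
open import Data.Product using (Σ; _×_)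
open import Relation.Binary.Definitions using (DecidableEquality)

open import Data.Nat using (zero; suc; _<_; _+_; _*_; _∸_; s≤s; z≤n)
open import Data.Nat.Properties
  using (+-assoc; +-comm; +-identityʳ; +-suc; suc-injective; ≤-reflexive; <⇒≤; m∸n+n≡m; m+1+n≢0; m≤n⇒∃[o]m+o≡n)
open import Data.List using ([]; _∷_; _++_; [_]; _∷ʳ_; filter; take; drop)
open import Data.List.Properties
  using (length-++; ++-assoc; ∷ʳ-++; filter-++; filter-accept; filter-reject; take-all; drop-drop; ∷ʳ-injectiveʳ)
open import Data.List.Relation.Unary.All as All using ([]; _∷_)
import Data.List.Relation.Unary.All.Properties as Allₚ
open import Data.List.Relation.Unary.AllPairs using ([]; _∷_)
open import Data.List.Relation.Unary.Any using (here; there)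
open import Data.List.Membership.Propositional using (_∉_)
open import Data.List.Relation.Binary.Sublist.Propositional using (_∷_; ⊆-refl; ⊆-trans; ⊆-reflexive)
open import Data.List.Relation.Binary.Sublist.Propositional.Properties using (++⁺; filter-⊆)
open import Data.Product using (∃-syntax; _,_; proj₁; proj₂)
open import Data.Empty using (⊥-elim)
open import Level using (0ℓ)
open import Relation.Nullary using (¬_; Dec; yes; no; contradiction)
open import Relation.Nullary.Decidable using (_×-dec_; ¬?)
open import Relation.Unary using (Pred; Decidable)
open import Relation.Unary.Properties using (∁?)
open import Relation.Binary.PropositionalEquality using (_≡_; refl; sym; trans; cong; cong₂; subst; module ≡-Reasoning)

module _ {A : Set} where

  split-at : ∀ m {n} (T : List A) → length T ≡ m + suc n →
             ∃[ X ] ∃[ z ] ∃[ T′ ] T ≡ X ++ z ∷ T′ × length X ≡ m × length T′ ≡ n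
  split-at zero    (z ∷ T) eq = [] , z , T , refl , refl , suc-injective eq
  split-at (suc m) (x ∷ T) eq with split-at m T (suc-injective eq)
  ... | X , z , T′ , refl , refl , |T′| = x ∷ X , z , T′ , refl , refl , |T′|

  init-last : ∀ (x : A) xs → ∃[ X ] ∃[ c ] x ∷ xs ≡ X ∷ʳ c
  init-last x []        = [] , x , refl
  init-last x (x′ ∷ xs) with init-last x′ xs
  ... | X , c , eq = x ∷ X , c , cong (x ∷_) eq

  ∷-∷ʳ-split : ∀ (Z : List A) → 2 ≤ length Z → ∃[ y ] ∃[ X ] ∃[ c ] Z ≡ y ∷ X ∷ʳ c
  ∷-∷ʳ-split (y ∷ x ∷ xs) _ with init-last x xs
  ... | X , c , eq = y , X , c , cong (y ∷_) eq
  ∷-∷ʳ-split (_ ∷ []) (s≤s ())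

  take-suc-length : ∀ (X : List A) z T → take (suc (length X)) (X ++ z ∷ T) ≡ X ∷ʳ z
  take-suc-length []      z T = refl
  take-suc-length (x ∷ X) z T = cong (x ∷_) (take-suc-length X z T)

  drop-length : ∀ (X Y : List A) → drop (length X) (X ++ Y) ≡ Y
  drop-length []      Y = refl
  drop-length (x ∷ X) Y = drop-length X Y

one-segment-length : ∀ {r} → 1 ≤ r → 1 * (r ∸ 1) + 1 ≡ r
one-segment-length 1≤r = trans (cong (_+ 1) (+-identityʳ _)) (m∸n+n≡m 1≤r)

tail-length : ∀ {s m k t} → s ≡ suc m → suc t ≡ s + k + 1 → t ≡ m + suc k
tail-length {m = m} {k} refl eq = trans (suc-injective eq) (trans (+-assoc m k 1) (cong (m +_) (+-comm k 1)))

module _ {A : Set} (_≟_ : DecidableEquality A) where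

  open import Data.List.Membership.DecPropositional _≟_ using (_∈?_)

  occ-++ : ∀ a (xs ys : List A) → occ _≟_ a (xs ++ ys) ≡ occ _≟_ a xs + occ _≟_ a ys
  occ-++ a xs ys = trans (cong length (filter-++ (_≟ a) xs ys)) (length-++ (filter (_≟ a) xs))

  occ-∉ : ∀ {a} {xs : List A} → a ∉ xs → occ _≟_ a xs ≡ 0
  occ-∉ {a} {[]}     _   = refl
  occ-∉ {a} {x ∷ xs} a∉ with x ≟ a
  ... | yes refl = contradiction (here refl) a∉
  ... | no  _    = occ-∉ (λ a∈xs → a∉ (there a∈xs))

  occ-unique : ∀ {a} {xs : List A} → Unique xs → a ∈ xs → occ _≟_ a xs ≡ 1
  occ-unique {a} {x ∷ xs} (x∉xs ∷ _) (here refl) with x ≟ x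
  ... | yes _   = cong suc (occ-∉ (λ x∈xs → All.lookup x∉xs x∈xs refl))
  ... | no  x≢x = contradiction refl x≢x
  occ-unique {a} {x ∷ xs} (x∉xs ∷ xs-unique) (there a∈xs) with x ≟ a
  ... | yes refl = contradiction refl (All.lookup x∉xs a∈xs)
  ... | no  _    = occ-unique xs-unique a∈xs

  module _ {p} {P : Pred A p} (P? : Decidable P) where

    occ-filter-accept : ∀ {a} → P a → ∀ xs → occ _≟_ a (filter P? xs) ≡ occ _≟_ a xs
    occ-filter-accept Pa []       = refl
    occ-filter-accept {a} Pa (x ∷ xs) with P? x
    ... | yes _ with x ≟ a
    ...   | yes _ = cong suc (occ-filter-accept Pa xs)
    ...   | no  _ = occ-filter-accept Pa xs
    occ-filter-accept {a} Pa (x ∷ xs) | no ¬Px with x ≟ a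
    ...   | yes refl = contradiction Pa ¬Px
    ...   | no  _    = occ-filter-accept Pa xs

    occ-filter-reject : ∀ {a} → ¬ P a → ∀ xs → occ _≟_ a (filter P? xs) ≡ 0
    occ-filter-reject ¬Pa []       = refl
    occ-filter-reject {a} ¬Pa (x ∷ xs) with P? x
    ... | no  _ = occ-filter-reject ¬Pa xs
    ... | yes Px with x ≟ a
    ...   | yes refl = contradiction Px ¬Pa
    ...   | no  _    = occ-filter-reject ¬Pa xs

  length-occ-+ : ∀ a (xs : List A) → length xs ≡ occ _≟_ a xs + length (filter (∁? (_≟ a)) xs)
  length-occ-+ a []       = refl
  length-occ-+ a (x ∷ xs) with x ≟ a
  ... | yes _ = cong suc (length-occ-+ a xs)
  ... | no  _ = trans (cong suc (length-occ-+ a xs)) (sym (+-suc _ _))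

  IsPermutationOf : List A → List A → Set
  IsPermutationOf ρ S = All (_∈ ρ) S × (∀ a → a ∈ ρ → occ _≟_ a S ≡ 1)

  length-permutation : ∀ {ρ S} → Unique ρ → IsPermutationOf ρ S → length S ≡ length ρ
  length-permutation {[]}    {[]}    _ _             = refl
  length-permutation {[]}    {_ ∷ _} _ (() ∷ _ , _)
  length-permutation {a ∷ ρ} {S} (a∉ρ ∷ ρ-unique) (S⊆aρ , once) = begin
    length S                   ≡⟨ length-occ-+ a S ⟩
    occ _≟_ a S + length S∖a   ≡⟨ cong₂ _+_ (once a (here refl)) (length-permutation ρ-unique (S∖a⊆ρ , S∖a-once)) ⟩
    suc (length ρ)             ∎
    where
      open ≡-Reasoning
      S∖a : List A
      S∖a = filter (∁? (_≟ a)) S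
      S∖a⊆ρ : All (_∈ ρ) S∖a
      S∖a⊆ρ = All.zipWith (λ { (here x≡a , x≢a) → contradiction x≡a x≢a ; (there x∈ρ , _) → x∈ρ })
                (Allₚ.filter⁺ (∁? (_≟ a)) S⊆aρ , Allₚ.all-filter (∁? (_≟ a)) S)
      S∖a-once : ∀ b → b ∈ ρ → occ _≟_ b S∖a ≡ 1
      S∖a-once b b∈ρ = trans (occ-filter-accept (∁? (_≟ a)) (λ b≡a → All.lookup a∉ρ b∈ρ (sym b≡a)) S)
                             (once b (there b∈ρ))

  Fresh : List A → List A → Pred A 0ℓ
  Fresh τ Cs a = a ∈ τ × a ∉ Cs

  fresh? : ∀ τ Cs → Decidable (Fresh τ Cs)
  fresh? τ Cs a = (a ∈? τ) ×-dec ¬? (a ∈? Cs)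

  restrict-permutation : ∀ {σ τ Cs S} → All (_∈ σ) τ → Unique Cs → All (_∈ τ) Cs →
                         IsPermutationOf σ S → IsPermutationOf τ (Cs ++ filter (fresh? τ Cs) S)
  restrict-permutation {σ} {τ} {Cs} {S} τ⊆σ Cs-unique Cs⊆τ (_ , S-once) =
    Allₚ.++⁺ Cs⊆τ (All.map proj₁ (Allₚ.all-filter (fresh? τ Cs) S)) ,
    λ a a∈τ → trans (occ-++ a Cs _) (once a∈τ (a ∈? Cs))
    where
      once : ∀ {a} → a ∈ τ → Dec (a ∈ Cs) →
             occ _≟_ a Cs + occ _≟_ a (filter (fresh? τ Cs) S) ≡ 1
      once a∈τ (yes a∈Cs) = cong₂ _+_ (occ-unique Cs-unique a∈Cs)
                                       (occ-filter-reject (fresh? τ Cs) (λ (_ , a∉Cs) → a∉Cs a∈Cs) S)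
      once a∈τ (no a∉Cs)  = cong₂ _+_ (occ-∉ a∉Cs)
                                       (trans (occ-filter-accept (fresh? τ Cs) (a∈τ , a∉Cs) S)
                                              (S-once _ (All.lookup τ⊆σ a∈τ)))

  data Chain (ρ : List A) : ℕ → List A → Set where
    end  : ∀ {W} → IsPermutationOf ρ W → Chain ρ 0 W
    link : ∀ {d y X z T} → IsPermutationOf ρ (y ∷ X ∷ʳ z) → Chain ρ d (z ∷ T) →
           Chain ρ (suc d) (y ∷ X ++ z ∷ T)

  segment-head : ∀ r y X z T → r ≡ suc (suc (length X)) →
                 segment _≟_ r 0 (y ∷ X ++ z ∷ T) ≡ y ∷ X ∷ʳ z
  segment-head _ y X z T refl = cong (y ∷_) (take-suc-length X z T)

  segment-suc : ∀ r i y X z T → r ≡ suc (suc (length X)) →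
                segment _≟_ r (suc i) (y ∷ X ++ z ∷ T) ≡ segment _≟_ r i (z ∷ T)
  segment-suc r i y X z T refl = cong (take r) (begin
    drop (suc (length X) + i * suc (length X)) (y ∷ X ++ z ∷ T)
      ≡⟨ drop-drop (suc (length X)) (i * suc (length X)) (y ∷ X ++ z ∷ T) ⟨
    drop (i * suc (length X)) (drop (length X) (X ++ z ∷ T))
      ≡⟨ cong (drop (i * suc (length X))) (drop-length X (z ∷ T)) ⟩
    drop (i * suc (length X)) (z ∷ T) ∎)
    where open ≡-Reasoning

  chain⇒colorful : ∀ {ρ d W} → Unique ρ → 1 ≤ length ρ → Chain ρ d W → Colorful _≟_ d ρ W
  chain⇒colorful {ρ} {W = W} ρ-unique 1≤|ρ| (end (W⊆ρ , once)) = W⊆ρ , |W| , segments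
    where
      |W|≡|ρ| : length W ≡ length ρ
      |W|≡|ρ| = length-permutation ρ-unique (W⊆ρ , once)
      |W| : length W ≡ 1 * (length ρ ∸ 1) + 1
      |W| = trans |W|≡|ρ| (sym (one-segment-length 1≤|ρ|))
      segments : ∀ i → i < 1 → ∀ a → a ∈ ρ → occ _≟_ a (segment _≟_ (length ρ) i W) ≡ 1
      segments zero _ a a∈ρ =
        trans (cong (occ _≟_ a) (take-all (length ρ) W (≤-reflexive |W|≡|ρ|))) (once a a∈ρ)
      segments (suc i) (s≤s ())
  chain⇒colorful {ρ} ρ-unique 1≤|ρ| (link {d} {y} {X} {z} {T} (S⊆ρ , once) chain)
    with chain⇒colorful ρ-unique 1≤|ρ| chain
  ... | zT⊆ρ , |zT| , segments′ = y∈ρ ∷ Allₚ.++⁺ X⊆ρ zT⊆ρ , |W| , segments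
    where
      open ≡-Reasoning
      y∈ρ : y ∈ ρ
      y∈ρ = All.head S⊆ρ
      X⊆ρ : All (_∈ ρ) X
      X⊆ρ = Allₚ.++⁻ˡ X (All.tail S⊆ρ)
      |ρ| : length ρ ≡ suc (suc (length X))
      |ρ| = trans (sym (length-permutation ρ-unique (S⊆ρ , once)))
                  (cong suc (trans (length-++ X) (+-comm (length X) 1)))
      k : ℕ
      k = suc d * (length ρ ∸ 1)
      |W| : length (y ∷ X ++ z ∷ T) ≡ suc (suc d) * (length ρ ∸ 1) + 1
      |W| = begin
        suc (length (X ++ z ∷ T))         ≡⟨ cong suc (length-++ X) ⟩
        suc (length X + length (z ∷ T))   ≡⟨ cong (λ n → suc (length X + n)) |zT| ⟩
        suc (length X + (k + 1))          ≡⟨ cong suc (+-assoc (length X) k 1) ⟨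
        suc (length X) + k + 1            ≡⟨ cong (λ s → s + k + 1) (cong (_∸ 1) |ρ|) ⟨
        length ρ ∸ 1 + k + 1              ∎
      segments : ∀ i → i < suc (suc d) → ∀ a → a ∈ ρ →
                 occ _≟_ a (segment _≟_ (length ρ) i (y ∷ X ++ z ∷ T)) ≡ 1
      segments zero    _        a a∈ρ =
        trans (cong (occ _≟_ a) (segment-head _ y X z T |ρ|)) (once a a∈ρ)
      segments (suc i) (s≤s i<) a a∈ρ =
        trans (cong (occ _≟_ a) (segment-suc _ i y X z T |ρ|)) (segments′ i i< a a∈ρ)

  colorful⇒chain : ∀ {ρ m d W} → length ρ ≡ suc (suc m) → Colorful _≟_ d ρ W → Chain ρ d W
  colorful⇒chain {ρ} {d = zero} {W} |ρ| (W⊆ρ , |W| , segments) =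
    end (W⊆ρ , λ a a∈ρ → trans (cong (occ _≟_ a) (sym (take-all (length ρ) W W≤ρ)))
                                (segments 0 (s≤s z≤n) a a∈ρ))
    where
      W≤ρ : length W ≤ length ρ
      W≤ρ = ≤-reflexive (trans |W| (one-segment-length (subst (1 ≤_) (sym |ρ|) (s≤s z≤n))))
  colorful⇒chain {d = suc d} {[]} |ρ| (_ , |W| , _) = ⊥-elim (m+1+n≢0 _ (sym |W|))
  colorful⇒chain {ρ} {m} {suc d} {y ∷ T} |ρ| (W⊆ρ , |W| , segments)
    with split-at m T (tail-length (cong (_∸ 1) |ρ|) |W|)
  ... | X , z , T′ , refl , refl , |T′| =
    link (y∈ρ ∷ Allₚ.++⁺ X⊆ρ (z∈ρ ∷ []) , once)
         (colorful⇒chain |ρ| (zT′⊆ρ , trans (cong suc |T′|) (+-comm 1 _) , segments′))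
    where
      once : ∀ a → a ∈ ρ → occ _≟_ a (y ∷ X ∷ʳ z) ≡ 1
      once a a∈ρ = trans (cong (occ _≟_ a) (sym (segment-head _ y X z T′ |ρ|)))
                         (segments 0 (s≤s z≤n) a a∈ρ)
      segments′ : ∀ i → i < suc d → ∀ a → a ∈ ρ → occ _≟_ a (segment _≟_ (length ρ) i (z ∷ T′)) ≡ 1
      segments′ i i< a a∈ρ = trans (cong (occ _≟_ a) (sym (segment-suc _ i y X z T′ |ρ|)))
                                   (segments (suc i) (s≤s i<) a a∈ρ)
      y∈ρ : y ∈ ρ
      y∈ρ = All.head W⊆ρ
      X⊆ρ : All (_∈ ρ) X
      X⊆ρ = proj₁ (Allₚ.++⁻ X (All.tail W⊆ρ))
      zT′⊆ρ : All (_∈ ρ) (z ∷ T′)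
      zT′⊆ρ = proj₂ (Allₚ.++⁻ X (All.tail W⊆ρ))
      z∈ρ : z ∈ ρ
      z∈ρ = All.head zT′⊆ρ

  link-⊆ : ∀ {τ Cs y X z T Z c V} → Cs ++ filter (fresh? τ Cs) (y ∷ X ∷ʳ z) ≡ Z ∷ʳ c →
           V ⊆ filter (fresh? τ [ c ]) [ z ] ++ T →
           filter (fresh? τ Cs) (y ∷ X ∷ʳ z) ++ V ⊆ filter (fresh? τ Cs) [ y ] ++ X ++ z ∷ T
  link-⊆ {τ} {Cs} {y} {X} {z} {T} {Z} {c} {V} shape V⊆ =
    ⊆-trans (⊆-reflexive (trans (cong (_++ V) filter-segment)
                                (trans (++-assoc Fy _ V) (cong (Fy ++_) (++-assoc FX _ V)))))
            (by-freshness (fresh? τ Cs z))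
    where
      open ≡-Reasoning
      P? : Decidable (Fresh τ Cs)
      P? = fresh? τ Cs
      Fy FX : List A
      Fy = filter P? [ y ]
      FX = filter P? X
      filter-segment : filter P? (y ∷ X ∷ʳ z) ≡ Fy ++ FX ++ filter P? [ z ]
      filter-segment = trans (filter-++ P? [ y ] (X ∷ʳ z)) (cong (Fy ++_) (filter-++ P? X [ z ]))
      by-freshness : Dec (Fresh τ Cs z) → Fy ++ FX ++ filter P? [ z ] ++ V ⊆ Fy ++ X ++ z ∷ T
      by-freshness (yes z-fresh) rewrite filter-accept P? {xs = []} z-fresh =
        ++⁺ (⊆-refl {x = Fy}) (++⁺ (filter-⊆ P? X) (refl ∷ V⊆T))
        where
          -- z is then the last letter of the current τ-segment, i.e. the carried letter c.
          z≡c : z ≡ c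
          z≡c = ∷ʳ-injectiveʳ (Cs ++ Fy ++ FX) Z (begin
            (Cs ++ Fy ++ FX) ∷ʳ z                 ≡⟨ ++-assoc Cs (Fy ++ FX) [ z ] ⟩
            Cs ++ (Fy ++ FX) ∷ʳ z                 ≡⟨ cong (Cs ++_) (++-assoc Fy FX [ z ]) ⟩
            Cs ++ Fy ++ FX ∷ʳ z                   ≡⟨ cong (λ Fz → Cs ++ Fy ++ FX ++ Fz) (filter-accept P? z-fresh) ⟨
            Cs ++ Fy ++ FX ++ filter P? [ z ]     ≡⟨ cong (Cs ++_) filter-segment ⟨
            Cs ++ filter P? (y ∷ X ∷ʳ z)          ≡⟨ shape ⟩
            Z ∷ʳ c                                ∎)
          V⊆T : V ⊆ T
          V⊆T = subst (λ Fz → V ⊆ Fz ++ T)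
                      (filter-reject (fresh? τ [ z ]) {xs = []} (λ (_ , z∉[z]) → z∉[z] (here refl)))
                      (subst (λ c → V ⊆ filter (fresh? τ [ c ]) [ z ] ++ T) (sym z≡c) V⊆)
      by-freshness (no z-stale) rewrite filter-reject P? {xs = []} z-stale =
        ++⁺ (⊆-refl {x = Fy})
            (++⁺ (filter-⊆ P? X) (⊆-trans V⊆ (++⁺ (filter-⊆ (fresh? τ [ c ]) [ z ]) ⊆-refl)))

  module _ {σ τ : List A} (τ⊆σ : All (_∈ σ) τ) (τ-unique : Unique τ) (2≤|τ| : 2 ≤ length τ) where

    -- Cs is the part of the current τ-segment chosen before the word y ∷ T starts; it may
    -- already contain y itself, which then must not be used again.
    Restricts : ℕ → A → List A → Set
    Restricts d y T = ∀ Cs → Unique Cs → All (_∈ τ) Cs →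
                      ∃[ V ] Chain τ d (Cs ++ V) × V ⊆ filter (fresh? τ Cs) [ y ] ++ T

    restrict-end : ∀ {y T} → IsPermutationOf σ (y ∷ T) → Restricts 0 y T
    restrict-end {y} {T} S Cs Cs-unique Cs⊆τ =
      filter (fresh? τ Cs) (y ∷ T) ,
      end (restrict-permutation τ⊆σ Cs-unique Cs⊆τ S) ,
      ⊆-trans (⊆-reflexive (filter-++ (fresh? τ Cs) [ y ] T)) (++⁺ ⊆-refl (filter-⊆ (fresh? τ Cs) T))

    restrict-link : ∀ {d y X z T} → IsPermutationOf σ (y ∷ X ∷ʳ z) → Restricts d z T →
                    Restricts (suc d) y (X ++ z ∷ T)
    restrict-link {d} {y} {X} {z} {T} S restrict-rest Cs Cs-unique Cs⊆τ =
      continue (∷-∷ʳ-split (Cs ++ F) (subst (2 ≤_) (sym (length-permutation τ-unique τ-segment)) 2≤|τ|))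
      where
        F : List A
        F = filter (fresh? τ Cs) (y ∷ X ∷ʳ z)
        τ-segment : IsPermutationOf τ (Cs ++ F)
        τ-segment = restrict-permutation τ⊆σ Cs-unique Cs⊆τ S
        continue : ∃[ y′ ] ∃[ X′ ] ∃[ c ] Cs ++ F ≡ y′ ∷ X′ ∷ʳ c →
                   ∃[ V ] Chain τ (suc d) (Cs ++ V) × V ⊆ filter (fresh? τ Cs) [ y ] ++ X ++ z ∷ T
        continue (y′ , X′ , c , shape)
          with restrict-rest [ c ] ([] ∷ []) (Allₚ.++⁻ʳ (y′ ∷ X′) (subst (All (_∈ τ)) shape (proj₁ τ-segment)))
        ... | V , chain , V⊆ =
          F ++ V ,
          subst (Chain τ (suc d)) glued (link (subst (IsPermutationOf τ) shape τ-segment) chain) ,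
          link-⊆ {τ} {Cs} {y} {X} {z} {T} {y′ ∷ X′} shape V⊆
          where
            open ≡-Reasoning
            glued : y′ ∷ X′ ++ c ∷ V ≡ Cs ++ F ++ V
            glued = begin
              y′ ∷ X′ ++ c ∷ V     ≡⟨ cong (y′ ∷_) (∷ʳ-++ X′ c V) ⟨
              (y′ ∷ X′ ∷ʳ c) ++ V  ≡⟨ cong (_++ V) shape ⟨
              (Cs ++ F) ++ V       ≡⟨ ++-assoc Cs F V ⟩
              Cs ++ F ++ V         ∎

    restrict-chain : ∀ {d y T} → Chain σ d (y ∷ T) → Restricts d y T
    restrict-chain (end S)        = restrict-end S
    restrict-chain (link S chain) = restrict-link S (restrict-chain chain)

lemma5p1 : {A : Set} (_≟_ : DecidableEquality A) (d : ℕ) → 1 ≤ d →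
    (σ : List A) → Unique σ → 2 ≤ length σ →
    (W : List A) → Colorful _≟_ d σ W →
    (τ : List A) → Unique τ → All (_∈ σ) τ → 2 ≤ length τ →
    Σ (List A) (λ V → (V ⊆ W) × Colorful _≟_ d τ V)
lemma5p1 _≟_ d _ σ _ _ [] (_ , |W| , _) _ _ _ _ = ⊥-elim (m+1+n≢0 _ (sym |W|))
lemma5p1 _≟_ d _ σ _ 2≤|σ| (y ∷ T) W-colorful τ τ-unique τ⊆σ 2≤|τ|
  with restrict-chain _≟_ τ⊆σ τ-unique 2≤|τ|
         (colorful⇒chain _≟_ (sym (proj₂ (m≤n⇒∃[o]m+o≡n 2≤|σ|))) W-colorful) [] [] []
... | V , τ-chain , V⊆ =
  V ,
  ⊆-trans V⊆ (++⁺ (filter-⊆ (fresh? _≟_ τ []) [ y ]) ⊆-refl) ,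
  chain⇒colorful _≟_ τ-unique (<⇒≤ 2≤|τ|) τ-chain
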